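{- Let $\phi$ be a formula and $\Sigma,\Gamma,\Delta$ finite multisets of formulas. In each of the calculi $\mathsf{G}^{\mathrm{fin}}$, $\mathsf{G}^{\mathrm{fin}}+\mathrm{Cut}$, $\mathsf{G}^\infty$, $\mathsf{G}^\infty+\mathrm{Cut}$: if $\phi,\Sigma\rhd\bot\Rightarrow\Sigma$ is provable, then $\Sigma\rhd\bot,\Gamma\Rightarrow\phi\rhd\bot,\Delta$ is provable.
   Context: Formulas: $\phi ::= p \mid \bot \mid \phi\to\phi \mid \phi\rhd\phi$. A sequent $\Gamma\Rightarrow\Delta$ is a pair of finite multisets of formulas; commas denote multiset union; $\Sigma\rhd\bot := \{\sigma\rhd\bot:\sigma\in\Sigma\}$; for formulas $\phi_0,\dots,\phi_{m-1}$, $\Phi_{[0,i)} := \{\phi_0,\dots,\phi_{i-1}\}$. Rules: (ax) $p,\Gamma\Rightarrow p,\Delta$ for a variable $p$; ($\bot$L) $\bot,\Gamma\Rightarrow\Delta$; ($\bot$R) from $\Gamma\Rightarrow\Delta$ infer $\Gamma\Rightarrow\bot,\Delta$; ($\to$L) from $\Gamma\Rightarrow\Delta,\phi$ and $\psi,\Gamma\Rightarrow\Delta$ infer $\phi\to\psi,\Gamma\Rightarrow\Delta$; ($\to$R) from $\phi,\Gamma\Rightarrow\Delta,\psi$ infer $\Gamma\Rightarrow\Delta,\phi\to\psi$; ($\rhd_{\mathsf{IL}}$) for $m\ge0$: from the premises $\psi_i,(\psi_i,\Phi_{[0,i)},\phi)\rhd\bot\Rightarrow\Phi_{[0,i)},\phi$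 ($i=0,\dots,m$) infer $\phi_0\rhd\psi_0,\dots,\phi_{m-1}\rhd\psi_{m-1},\Gamma\Rightarrow\psi_m\rhd\phi,\Delta$; ($\rhd_{\mathsf{IK4}}$) the same conclusion from the premises $\psi_i,(\Phi_{[0,i)},\phi)\rhd\bot\Rightarrow\Phi_{[0,i)},\phi$ ($i=0,\dots,m$); (Cut) from $\Gamma\Rightarrow\Delta,\chi$ and $\chi,\Gamma\Rightarrow\Delta$ infer $\Gamma\Rightarrow\Delta$. $\mathsf{G}^{\mathrm{fin}}$: finite proof trees using ax, $\bot$L, $\bot$R, $\to$L, $\to$R, $\rhd_{\mathsf{IL}}$; $\mathsf{G}^{\mathrm{fin}}+\mathrm{Cut}$ adds Cut. $\mathsf{G}^\infty$(+Cut): a proof is a possibly infinite, finitely branching tree whose nodes are labelled with sequents and rules among ax, $\bot$L, $\bot$R, $\to$L, $\to$R, $\rhd_{\mathsf{IK4}}$ (and Cut), each node with its children being an instance of its rule (leaves are ax or $\bot$L), such that every infinite branch passes infinitely often from the conclusion of a $\rhd_{\mathsf{IK4}}$ instance to one of its premises. -}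

module Defs where

open import Data.Nat using (ℕ; zero; suc; _≤_; _<_)
open import Data.List using (List; []; _∷_; _++_; [_]; map; upTo)
open import Data.List.Relation.Unary.All using (All)
open import Data.List.Relation.Binary.Permutation.Propositional using (_↭_)
open import Data.Product using (_×_; _,_; proj₁; proj₂; ∃-syntax)
open import Data.Unit using (⊤)
open import Relation.Binary.PropositionalEquality using (_≡_)

infixr 6 _⇒ᶠ_ _▷_
infix 4 _⇒_

data Formula : Set where
  var  : ℕ → Formula
  bot  : Formula
  _⇒ᶠ_ : Formula → Formula → Formula
  _▷_  : Formula → Formula → Formula

-- Sequents: pairs of finite multisets, represented by lists; every rule
-- below matches its conclusion only up to permutation (_↭_), so that
-- sequents are effectively multisets.

record Sequent : Set where
  constructor _⇒_
  field
    ante : List Formula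
    succ : List Formula

_▷⊥ : List Formula → List Formula
Σ ▷⊥ = map (λ σ → σ ▷ bot) Σ

-- The left principal formulas
-- φ₀ ▷ ψ₀, …, φ_{m-1} ▷ ψ_{m-1} are given as the list of pairs (φᵢ , ψᵢ);
-- the right principal formula is ψₘ ▷ φ.  The premise number i is
--   IL :  ψᵢ , (ψᵢ , Φ_[0,i) , φ) ▷ ⊥ ⇒ Φ_[0,i) , φ
--   IK4:  ψᵢ , (Φ_[0,i) , φ) ▷ ⊥     ⇒ Φ_[0,i) , φ
-- for i = 0, …, m (with ψᵢ for i = m being ψₘ).

premIL : Formula → List Formula → Formula → Sequent
premIL ψ Φ φ = (ψ ∷ ((ψ ∷ (Φ ++ [ φ ])) ▷⊥)) ⇒ (Φ ++ [ φ ])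

premIK4 : Formula → List Formula → Formula → Sequent
premIK4 ψ Φ φ = (ψ ∷ ((Φ ++ [ φ ]) ▷⊥)) ⇒ (Φ ++ [ φ ])

-- premises i = k, …, m, where Φacc = Φ_[0,k) and the list holds (φᵢ,ψᵢ) for k ≤ i < m
premsWith : (Formula → List Formula → Formula → Sequent) →
            List Formula → List (Formula × Formula) → Formula → Formula → List Sequent
premsWith prem Φacc []              ψm φ = [ prem ψm Φacc φ ]
premsWith prem Φacc ((φi , ψi) ∷ L) ψm φ = prem ψi Φacc φ ∷ premsWith prem (Φacc ++ [ φi ]) L ψm φ

boxedPairs : List (Formula × Formula) → List Formula
boxedPairs L = map (λ q → proj₁ q ▷ proj₂ q) L

data Rule : Set where
  ax botL botR impL impR boxIL boxIK4 cut : Rule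

data Instance : Rule → Sequent → List Sequent → Set where
  ax     : ∀ {Γc Δc} p Γ Δ → Γc ↭ var p ∷ Γ → Δc ↭ var p ∷ Δ →
           Instance ax (Γc ⇒ Δc) []
  botL   : ∀ {Γc Δc} Γ → Γc ↭ bot ∷ Γ →
           Instance botL (Γc ⇒ Δc) []
  botR   : ∀ {Γc Δc} Γ Δ → Γc ↭ Γ → Δc ↭ bot ∷ Δ →
           Instance botR (Γc ⇒ Δc) [ Γ ⇒ Δ ]
  impL   : ∀ {Γc Δc} φ ψ Γ Δ → Γc ↭ (φ ⇒ᶠ ψ) ∷ Γ → Δc ↭ Δ →
           Instance impL (Γc ⇒ Δc) ((Γ ⇒ Δ ++ [ φ ]) ∷ (ψ ∷ Γ ⇒ Δ) ∷ [])
  impR   : ∀ {Γc Δc} φ ψ Γ Δ → Γc ↭ Γ → Δc ↭ (φ ⇒ᶠ ψ) ∷ Δ →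
           Instance impR (Γc ⇒ Δc) [ φ ∷ Γ ⇒ Δ ++ [ ψ ] ]
  boxIL  : ∀ {Γc Δc} (L : List (Formula × Formula)) ψm φ Γ Δ →
           Γc ↭ boxedPairs L ++ Γ → Δc ↭ (ψm ▷ φ) ∷ Δ →
           Instance boxIL (Γc ⇒ Δc) (premsWith premIL [] L ψm φ)
  boxIK4 : ∀ {Γc Δc} (L : List (Formula × Formula)) ψm φ Γ Δ →
           Γc ↭ boxedPairs L ++ Γ → Δc ↭ (ψm ▷ φ) ∷ Δ →
           Instance boxIK4 (Γc ⇒ Δc) (premsWith premIK4 [] L ψm φ)
  cut    : ∀ Γ Δ χ →
           Instance cut (Γ ⇒ Δ) ((Γ ⇒ Δ ++ [ χ ]) ∷ (χ ∷ Γ ⇒ Δ) ∷ [])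

data RulesFin : Rule → Set where
  ax : RulesFin ax ; botL : RulesFin botL ; botR : RulesFin botR
  impL : RulesFin impL ; impR : RulesFin impR ; boxIL : RulesFin boxIL

data RulesFinCut : Rule → Set where
  ax : RulesFinCut ax ; botL : RulesFinCut botL ; botR : RulesFinCut botR
  impL : RulesFinCut impL ; impR : RulesFinCut impR ; boxIL : RulesFinCut boxIL
  cut : RulesFinCut cut

data RulesInf : Rule → Set where
  ax : RulesInf ax ; botL : RulesInf botL ; botR : RulesInf botR
  impL : RulesInf impL ; impR : RulesInf impR ; boxIK4 : RulesInf boxIK4

data RulesInfCut : Rule → Set where
  ax : RulesInfCut ax ; botL : RulesInfCut botL ; botR : RulesInfCut botR
  impL : RulesInfCut impL ; impR : RulesInfCut impR ; boxIK4 : RulesInfCut boxIK4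
  cut : RulesInfCut cut

data FinProof (R : Rule → Set) : Sequent → Set where
  node : ∀ {s} (r : Rule) → R r → (ps : List Sequent) → Instance r s ps →
         All (FinProof R) ps → FinProof R s

-- Nodes are addressed by
-- paths (lists of child indices, most recent step first; the root is []).

record Tree : Set where
  field
    seqAt   : List ℕ → Sequent
    ruleAt  : List ℕ → Rule
    arity   : List ℕ → ℕ

  Node : List ℕ → Set
  Node []      = ⊤
  Node (i ∷ a) = Node a × i < arity a

  children : List ℕ → List Sequent
  children a = map (λ i → seqAt (i ∷ a)) (upTo (arity a))

  path : (ℕ → ℕ) → ℕ → List ℕ
  path b zero    = []
  path b (suc n) = b n ∷ path b n

  IsBranch : (ℕ → ℕ) → Set
  IsBranch b = ∀ n → b n < arity (path b n)

open Tree public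

record InfProof (R : Rule → Set) (s : Sequent) : Set where
  field
    tree    : Tree
    root    : seqAt tree [] ≡ s
    allowed : ∀ a → Node tree a → R (ruleAt tree a)
    local   : ∀ a → Node tree a → Instance (ruleAt tree a) (seqAt tree a) (children tree a)
    fair    : ∀ b → IsBranch tree b →
              ∀ n → ∃[ m ] (n ≤ m × ruleAt tree (path tree b m) ≡ boxIK4)

data Calculus : Set where
  Gfin GfinCut Ginf GinfCut : Calculus

Provable : Calculus → Sequent → Set
Provable Gfin    s = FinProof RulesFin s
Provable GfinCut s = FinProof RulesFinCut s
Provable Ginf    s = InfProof RulesInf s
Provable GinfCut s = InfProof RulesInfCut s

{-# OPTIONS --safe #-}
-- Apply the modal rule with left principal formulas σ ▷ ⊥ (σ ∈ Σ) and right principal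
-- formula φ ▷ ⊥, i.e. with φᵢ = σᵢ, ψᵢ = ⊥, ψₘ = φ and ⊥ in place of the rule's φ.
-- Every premise i < m then has ⊥ on the left, and the last one,
-- φ , (…, Σ, ⊥) ▷ ⊥ ⇒ Σ, ⊥, follows from the hypothesis by weakening and ⊥R.
-- Both kinds of proofs are closed under rule application and left weakening.  An
-- infinite proof is weakened only down to the first modal rule of each branch, whose
-- premises have no context, so fairness is untouched; rule application grafts the
-- proofs of the premises below a new root.

module Submission where

open import Defs
open import Data.Bool using (Bool; true; false; _∧_)
open import Data.List
  using (List; []; _∷_; _++_; [_]; _∷ʳ_; map; upTo; applyUpTo; length; initLast; _∷ʳ′_)
open import Data.List.Properties using (map-id; map-∘; map-++; map-cong; map-upTo; ++-assoc; ++-identityʳ)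
open import Data.List.Relation.Unary.All using (All; []; _∷_)
open import Data.List.Relation.Binary.Permutation.Propositional
  using (_↭_; ↭-refl; ↭-trans; ↭-sym; ↭-reflexive; prep)
open import Data.List.Relation.Binary.Permutation.Propositional.Properties using (++⁺ʳ; shift; ++-comm)
open import Data.Nat using (ℕ; zero; suc; _≤_; _<_; s≤s)
open import Data.Nat.Properties using (≤-trans; n≤1+n)
open import Data.Product using (_×_; _,_; ∃-syntax)
open import Data.Unit using (tt)
open import Function using (_∘_)
open import Relation.Binary.PropositionalEquality
  using (_≡_; refl; sym; trans; cong; cong₂; subst; module ≡-Reasoning)

keepsContext : Rule → Bool
keepsContext boxIL  = false
keepsContext boxIK4 = false
keepsContext _      = true

weakenIf : Bool → List Formula → Sequent → Sequent
weakenIf false Ξ s       = s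
weakenIf true  Ξ (Γ ⇒ Δ) = Γ ++ Ξ ⇒ Δ

++⁺ʳ-assoc : ∀ {Γc : List Formula} Ξ Θ Γ → Γc ↭ Θ ++ Γ → Γc ++ Ξ ↭ Θ ++ Γ ++ Ξ
++⁺ʳ-assoc Ξ Θ Γ Γc↭ = ↭-trans (++⁺ʳ Ξ Γc↭) (↭-reflexive (++-assoc Θ Γ Ξ))

Instance-weakenˡ : ∀ {r s ps} Ξ → Instance r s ps →
  Instance r (weakenIf true Ξ s) (map (weakenIf (keepsContext r) Ξ) ps)
Instance-weakenˡ Ξ (ax p Γ Δ pΓ pΔ)         = ax p (Γ ++ Ξ) Δ (++⁺ʳ Ξ pΓ) pΔ
Instance-weakenˡ Ξ (botL Γ pΓ)              = botL (Γ ++ Ξ) (++⁺ʳ Ξ pΓ)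
Instance-weakenˡ Ξ (botR Γ Δ pΓ pΔ)         = botR (Γ ++ Ξ) Δ (++⁺ʳ Ξ pΓ) pΔ
Instance-weakenˡ Ξ (impL φ ψ Γ Δ pΓ pΔ)     = impL φ ψ (Γ ++ Ξ) Δ (++⁺ʳ Ξ pΓ) pΔ
Instance-weakenˡ Ξ (impR φ ψ Γ Δ pΓ pΔ)     = impR φ ψ (Γ ++ Ξ) Δ (++⁺ʳ Ξ pΓ) pΔ
Instance-weakenˡ Ξ (boxIL L ψm φ Γ Δ pΓ pΔ) =
  subst (Instance _ _) (sym (map-id _)) (boxIL L ψm φ (Γ ++ Ξ) Δ (++⁺ʳ-assoc Ξ (boxedPairs L) Γ pΓ) pΔ)
Instance-weakenˡ Ξ (boxIK4 L ψm φ Γ Δ pΓ pΔ) =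
  subst (Instance _ _) (sym (map-id _)) (boxIK4 L ψm φ (Γ ++ Ξ) Δ (++⁺ʳ-assoc Ξ (boxedPairs L) Γ pΓ) pΔ)
Instance-weakenˡ Ξ (cut Γ Δ χ)              = cut (Γ ++ Ξ) Δ χ

Instance-weakenIf : ∀ {r s ps} b Ξ → Instance r s ps →
  Instance r (weakenIf b Ξ s) (map (weakenIf (b ∧ keepsContext r) Ξ) ps)
Instance-weakenIf false Ξ inst = subst (Instance _ _) (sym (map-id _)) inst
Instance-weakenIf true  Ξ inst = Instance-weakenˡ Ξ inst

module _ {R : Rule → Set} (Ξ : List Formula) where

  mutual
    FinProof-weakenˡ : ∀ {s} → FinProof R s → FinProof R (weakenIf true Ξ s)
    FinProof-weakenˡ (node r rr ps inst subs) =
      node r rr _ (Instance-weakenˡ Ξ inst) (All-FinProof-weakenIf (keepsContext r) subs)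

    All-FinProof-weakenIf : ∀ b {ps} → All (FinProof R) ps → All (FinProof R) (map (weakenIf b Ξ) ps)
    All-FinProof-weakenIf b     []       = []
    All-FinProof-weakenIf false (p ∷ ps) = p ∷ All-FinProof-weakenIf false ps
    All-FinProof-weakenIf true  (p ∷ ps) = FinProof-weakenˡ p ∷ All-FinProof-weakenIf true ps

Fair : Tree → Set
Fair T = ∀ b → IsBranch T b → ∀ n → ∃[ m ] (n ≤ m × ruleAt T (path T b m) ≡ boxIK4)

record IsProofTree (R : Rule → Set) (T : Tree) : Set where
  field
    allowed : ∀ a → Node T a → R (ruleAt T a)
    local   : ∀ a → Node T a → Instance (ruleAt T a) (seqAt T a) (children T a)
    fair    : Fair T

module _ {R : Rule → Set} where

  isProofTree : ∀ {s} (P : InfProof R s) → IsProofTree R (InfProof.tree P)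
  isProofTree P = record { allowed = allowed ; local = local ; fair = fair }
    where open InfProof P

  toInfProof : ∀ {s} T → seqAt T [] ≡ s → IsProofTree R T → InfProof R s
  toInfProof T root isT = record { tree = T ; root = root ; allowed = allowed ; local = local ; fair = fair }
    where open IsProofTree isT

path-irrelevant : ∀ T T′ b n → path T b n ≡ path T′ b n
path-irrelevant T T′ b zero    = refl
path-irrelevant T T′ b (suc n) = cong (b n ∷_) (path-irrelevant T T′ b n)

path-suc : ∀ T T′ b n → path T b (suc n) ≡ path T′ (b ∘ suc) n ∷ʳ b 0
path-suc T T′ b zero    = refl
path-suc T T′ b (suc n) = cong (b (suc n) ∷_) (path-suc T T′ b n)

relabel : Tree → (List ℕ → Sequent) → Tree
relabel T f = record T { seqAt = f }

Node-relabel : ∀ T f a → Node (relabel T f) a → Node T a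
Node-relabel T f []      tt         = tt
Node-relabel T f (i ∷ a) (isN , i<) = Node-relabel T f a isN , i<

Fair-relabel : ∀ T f → Fair T → Fair (relabel T f)
Fair-relabel T f fair b isB n with fair b isB′ n
  where
  isB′ : IsBranch T b
  isB′ k = subst (λ a → b k < arity T a) (path-irrelevant (relabel T f) T b k) (isB k)
... | m , n≤m , isIK4 = m , n≤m , trans (cong (ruleAt T) (path-irrelevant (relabel T f) T b m)) isIK4

module _ {R : Rule → Set} (Ξ : List Formula) where

  InfProof-weakenˡ : ∀ {s} → InfProof R s → InfProof R (weakenIf true Ξ s)
  InfProof-weakenˡ P = toInfProof T′ (cong (weakenIf true Ξ) root) record
    { allowed = λ a → allowed a ∘ Node-relabel T label a
    ; local   = λ a isN → subst (Instance _ _) (sym (map-∘ (upTo (arity T a))))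
                            (Instance-weakenIf (weakened a) Ξ (local a (Node-relabel T label a isN)))
    ; fair    = Fair-relabel T label fair
    }
    where
    open InfProof P
    T : Tree
    T = tree
    weakened : List ℕ → Bool
    weakened []      = true
    weakened (i ∷ a) = weakened a ∧ keepsContext (ruleAt T a)
    label : List ℕ → Sequent
    label a = weakenIf (weakened a) Ξ (seqAt T a)
    T′ : Tree
    T′ = relabel T label

graftAt : {A : Set} → A → (ℕ → List ℕ → A) → List ℕ → A
graftAt x f []      = x
graftAt x f (i ∷ a) = graftAt (f i []) (λ j c → f j (i ∷ c)) a

graftAt-∷ʳ : ∀ {A : Set} (x : A) f a i → graftAt x f (a ∷ʳ i) ≡ f i a
graftAt-∷ʳ x f []      i = refl
graftAt-∷ʳ x f (j ∷ a) i = graftAt-∷ʳ (f j []) (λ k c → f k (j ∷ c)) a i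

graftAt-path : ∀ {A : Set} T T′ (x : A) f b n →
  graftAt x f (path T b (suc n)) ≡ f (b 0) (path T′ (b ∘ suc) n)
graftAt-path T T′ x f b n = trans (cong (graftAt x f) (path-suc T T′ b n)) (graftAt-∷ʳ x f _ (b 0))

graft : Sequent → Rule → ℕ → (ℕ → Tree) → Tree
graft s r n t = record
  { seqAt  = graftAt s (seqAt ∘ t)
  ; ruleAt = graftAt r (ruleAt ∘ t)
  ; arity  = graftAt n (arity ∘ t)
  }

module _ {s : Sequent} {r : Rule} {n : ℕ} {t : ℕ → Tree} where

  private
    G : Tree
    G = graft s r n t

  Node-graft : ∀ a i → Node G (a ∷ʳ i) → i < n × Node (t i) a
  Node-graft []      i (tt , i<n) = i<n , tt
  Node-graft (j ∷ a) i (isN , j<)  with Node-graft a i isN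
  ... | i<n , isN′ = i<n , isN′ , subst (j <_) (graftAt-∷ʳ n (arity ∘ t) a i) j<

  children-graft : ∀ a i → children G (a ∷ʳ i) ≡ children (t i) a
  children-graft a i = begin
    map (λ j → seqAt G (j ∷ a ∷ʳ i)) (upTo (arity G (a ∷ʳ i)))
      ≡⟨ cong (λ k → map (λ j → seqAt G (j ∷ a ∷ʳ i)) (upTo k)) (graftAt-∷ʳ n (arity ∘ t) a i) ⟩
    map (λ j → seqAt G (j ∷ a ∷ʳ i)) (upTo (arity (t i) a))
      ≡⟨ map-cong (λ j → graftAt-∷ʳ s (seqAt ∘ t) (j ∷ a) i) _ ⟩
    children (t i) a ∎
    where open ≡-Reasoning

  IsBranch-graft : ∀ b → IsBranch G b → IsBranch (t (b 0)) (b ∘ suc)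
  IsBranch-graft b isB k = subst (b (suc k) <_) (graftAt-path G (t (b 0)) n (arity ∘ t) b k) (isB (suc k))

  Fair-graft : (∀ {i} → i < n → Fair (t i)) → Fair G
  Fair-graft fair b isB k with fair (isB 0) (b ∘ suc) (IsBranch-graft b isB) k
  ... | m , k≤m , isIK4 =
    suc m , ≤-trans k≤m (n≤1+n m) , trans (graftAt-path G (t (b 0)) r (ruleAt ∘ t) b m) isIK4

  IsProofTree-graft : ∀ {R} → R r → Instance r s (applyUpTo (λ i → seqAt (t i) []) n) →
    (∀ {i} → i < n → IsProofTree R (t i)) → IsProofTree R G
  IsProofTree-graft {R} rr inst sub = record
    { allowed = allowed
    ; local   = local
    ; fair    = Fair-graft (IsProofTree.fair ∘ sub)
    }
    where
    allowed : ∀ a → Node G a → R (ruleAt G a)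
    allowed a isN with initLast a
    ... | []       = rr
    ... | a′ ∷ʳ′ i with Node-graft a′ i isN
    ... | i<n , isN′ =
      subst R (sym (graftAt-∷ʳ r (ruleAt ∘ t) a′ i)) (IsProofTree.allowed (sub i<n) a′ isN′)

    local : ∀ a → Node G a → Instance (ruleAt G a) (seqAt G a) (children G a)
    local a isN with initLast a
    ... | []       = subst (Instance r s) (sym (map-upTo _ n)) inst
    ... | a′ ∷ʳ′ i with Node-graft a′ i isN
    ... | i<n , isN′
      rewrite graftAt-∷ʳ r (ruleAt ∘ t) a′ i | graftAt-∷ʳ s (seqAt ∘ t) a′ i | children-graft a′ i =
        IsProofTree.local (sub i<n) a′ isN′

module _ {R : Rule → Set} where

  -- The junk tree at indices i ≥ length ps is never reached: the new root has arity length ps.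
  subtree : ∀ {ps} → All (InfProof R) ps → ℕ → Tree
  subtree []       _       = record { seqAt = λ _ → [] ⇒ [] ; ruleAt = λ _ → ax ; arity = λ _ → 0 }
  subtree (P ∷ _)  zero    = InfProof.tree P
  subtree (_ ∷ Ps) (suc i) = subtree Ps i

  IsProofTree-subtree : ∀ {ps} (Ps : All (InfProof R) ps) {i} → i < length ps →
    IsProofTree R (subtree Ps i)
  IsProofTree-subtree (P ∷ _)  {zero}  _         = isProofTree P
  IsProofTree-subtree (_ ∷ Ps) {suc i} (s≤s i<n) = IsProofTree-subtree Ps i<n

  roots-subtree : ∀ {ps} (Ps : All (InfProof R) ps) →
    applyUpTo (λ i → seqAt (subtree Ps i) []) (length ps) ≡ ps
  roots-subtree []       = refl
  roots-subtree (P ∷ Ps) = cong₂ _∷_ (InfProof.root P) (roots-subtree Ps)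

  InfProof-infer : ∀ {r s ps} → R r → Instance r s ps → All (InfProof R) ps → InfProof R s
  InfProof-infer {r} {s} {ps} rr inst Ps = toInfProof (graft s r (length ps) (subtree Ps)) refl
    (IsProofTree-graft rr (subst (Instance r s) (sym (roots-subtree Ps)) inst) (IsProofTree-subtree Ps))

record Derivability (R : Rule → Set) (P : Sequent → Set) : Set where
  field
    infer   : ∀ {r s ps} → R r → Instance r s ps → All P ps → P s
    weakenˡ : ∀ Ξ {s} → P s → P (weakenIf true Ξ s)

finDerivability : ∀ {R} → Derivability R (FinProof R)
finDerivability = record { infer = λ rr inst → node _ rr _ inst ; weakenˡ = FinProof-weakenˡ }

infDerivability : ∀ {R} → Derivability R (InfProof R)
infDerivability = record { infer = InfProof-infer ; weakenˡ = InfProof-weakenˡ }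

module _ {P : Sequent → Set} (prem : Formula → List Formula → Formula → Sequent) (ψ χ : Formula)
         (⊥-prem : ∀ Φ → P (prem bot Φ χ)) where

  private
    Last : List Formula → Set
    Last Φ = P (prem ψ Φ χ)

  All-premsWith-⊥ : ∀ Φ Σ → Last (Φ ++ Σ) → All P (premsWith prem Φ (map (_, bot) Σ) ψ χ)
  All-premsWith-⊥ Φ []      last = subst Last (++-identityʳ Φ) last ∷ []
  All-premsWith-⊥ Φ (σ ∷ Σ) last =
    ⊥-prem Φ ∷ All-premsWith-⊥ (Φ ++ [ σ ]) Σ (subst Last (sym (++-assoc Φ [ σ ] Σ)) last)

boxedPairs-⊥ : ∀ Σ Γ → Σ ▷⊥ ++ Γ ↭ boxedPairs (map (_, bot) Σ) ++ Γ
boxedPairs-⊥ Σ Γ = ↭-reflexive (cong (_++ Γ) (map-∘ Σ))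

module _ {R : Rule → Set} {P : Sequent → Set} (D : Derivability R P) (⊥L : R botL) (⊥R : R botR) where
  open Derivability D

  ⊥-left : ∀ {Γ Δ} → P (bot ∷ Γ ⇒ Δ)
  ⊥-left = infer ⊥L (botL _ ↭-refl) []

  weaken-⊥R : ∀ {Γ Δ Γ′} Ξ → Γ′ ↭ Γ ++ Ξ → P (Γ ⇒ Δ) → P (Γ′ ⇒ Δ ++ [ bot ])
  weaken-⊥R {Δ = Δ} Ξ Γ′↭ p = infer ⊥R (botR _ Δ Γ′↭ (++-comm Δ [ bot ])) (weakenˡ Ξ p ∷ [])

  ▷⊥-IL : R boxIL → ∀ φ Σ Γ Δ → P (φ ∷ Σ ▷⊥ ⇒ Σ) → P (Σ ▷⊥ ++ Γ ⇒ (φ ▷ bot) ∷ Δ)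
  ▷⊥-IL box φ Σ Γ Δ p =
    infer box (boxIL (map (_, bot) Σ) φ bot Γ Δ (boxedPairs-⊥ Σ Γ) ↭-refl)
      (All-premsWith-⊥ premIL φ bot (λ _ → ⊥-left) [] Σ (weaken-⊥R ((φ ▷ bot) ∷ [ bot ▷ bot ]) reorder p))
    where
    reorder : φ ∷ (φ ∷ Σ ++ [ bot ]) ▷⊥ ↭ (φ ∷ Σ ▷⊥) ++ (φ ▷ bot) ∷ [ bot ▷ bot ]
    reorder = prep φ (↭-trans (↭-reflexive (cong ((φ ▷ bot) ∷_) (map-++ _ Σ [ bot ])))
                              (↭-sym (shift (φ ▷ bot) (Σ ▷⊥) [ bot ▷ bot ])))

  ▷⊥-IK4 : R boxIK4 → ∀ φ Σ Γ Δ → P (φ ∷ Σ ▷⊥ ⇒ Σ) → P (Σ ▷⊥ ++ Γ ⇒ (φ ▷ bot) ∷ Δ)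
  ▷⊥-IK4 box φ Σ Γ Δ p =
    infer box (boxIK4 (map (_, bot) Σ) φ bot Γ Δ (boxedPairs-⊥ Σ Γ) ↭-refl)
      (All-premsWith-⊥ premIK4 φ bot (λ _ → ⊥-left) [] Σ (weaken-⊥R [ bot ▷ bot ] reorder p))
    where
    reorder : φ ∷ (Σ ++ [ bot ]) ▷⊥ ↭ (φ ∷ Σ ▷⊥) ++ [ bot ▷ bot ]
    reorder = ↭-reflexive (cong (φ ∷_) (map-++ _ Σ [ bot ]))

mainTheorem16 : (C : Calculus) (φ : Formula) (Σ Γ Δ : List Formula) →
    Provable C (φ ∷ (Σ ▷⊥) ⇒ Σ) →
    Provable C ((Σ ▷⊥) ++ Γ ⇒ (φ ▷ bot) ∷ Δ)
mainTheorem16 Gfin    = ▷⊥-IL  finDerivability botL botR boxIL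
mainTheorem16 GfinCut = ▷⊥-IL  finDerivability botL botR boxIL
mainTheorem16 Ginf    = ▷⊥-IK4 infDerivability botL botR boxIK4
mainTheorem16 GinfCut = ▷⊥-IK4 infDerivability botL botR boxIK4
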